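{- Let $(X,A,f,\alpha)$ be an invertible micro-macro dynamical system and $\varepsilon_1,\varepsilon_2\in[0,1]$. (1) If $|X^{\mathrm{eq}}|\ge(1-\varepsilon_1)|X|$, then $|D|\le\varepsilon_1|X|$ (property $\mathrm{L}_1(\varepsilon_1)$). (2) If $|D\cap X^{\mathrm{eq}}|\ge(1-\varepsilon_2)|X^{\mathrm{neq}}|$, then $|I\cap X^{\mathrm{neq}}|\ge(1-\varepsilon_2)|X^{\mathrm{neq}}|$ (property $\mathrm{GAT}(\varepsilon_2)$). (3) If both $|X^{\mathrm{eq}}|\ge(1-\varepsilon_1)|X|$ and $|D\cap X^{\mathrm{eq}}|\ge(1-\varepsilon_2)|X^{\mathrm{neq}}|$, then the system satisfies both properties $\mathrm{L}_1(\varepsilon_1)$ and $\mathrm{GAT}(\varepsilon_2)$ (property $\mathrm{L}_2(\varepsilon_1,\varepsilon_2)$).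
   Context: A micro-macro dynamical system is a tuple $(X,A,f,\alpha)$ with $X,A$ finite sets, $f:X\to A$ surjective and $\alpha:X\to X$; it is invertible if $\alpha$ is a bijection. For $i\in X$, $|i|=|f^{ -1}(f(i))|$ and $S(i)=\ln|i|$. $X^{\mathrm{eq}}$ is the set of $i\in X$ with $f(i)$ a macrostate of maximal cardinality $|f^{ -1}(a)|$, $X^{\mathrm{neq}}=X\setminus X^{\mathrm{eq}}$. $D=\{i:S(\alpha(i))<S(i)\}$, $I=\{i:S(\alpha(i))>S(i)\}$.
   Formalization: The parameters ε₁ and ε₂ range only over the rational numbers in [0,1]. -}

module Defs where

import Level
open import Data.Nat using (ℕ; _<_; _>_; _⊔_)
open import Data.Nat.Properties using (_<?_; _≟_)
open import Data.Fin using (Fin)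
import Data.Fin.Properties as FinP
open import Data.List using (List; length; filter; map; foldr)
open import Data.Integer using (+_)
open import Data.Rational using (ℚ; _/_; _*_; _-_; _≤_; 0ℚ; 1ℚ)
open import Data.Product using (_×_; ∃)
open import Relation.Binary.PropositionalEquality using (_≡_)
open import Relation.Nullary using (Dec; ¬_)
open import Relation.Unary using (Pred; Decidable; _∩_)
open import Relation.Nullary.Decidable using (_×-dec_; ¬?)
open import Function.Definitions using (Surjective; Bijective)
open import Data.List using (allFin) public

ℕ→ℚ : ℕ → ℚ
ℕ→ℚ n = + n / 1

card : ∀ {n} {P : Pred (Fin n) Level.zero} → Decidable P → ℕ
card {n} P? = length (filter P? (allFin n))

-- micro-macro dynamical system with X = Fin n, A = Fin m
record MMDS (n m : ℕ) : Set where
  field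
    f     : Fin n → Fin m
    f-surj : Surjective _≡_ _≡_ f
    α     : Fin n → Fin n

Invertible : ∀ {n m} → MMDS n m → Set
Invertible sys = Bijective _≡_ _≡_ (MMDS.α sys)

module _ {n m : ℕ} (sys : MMDS n m) where
  open MMDS sys

  fiberSize : Fin m → ℕ
  fiberSize a = card (λ j → f j FinP.≟ a)

  size : Fin n → ℕ
  size i = fiberSize (f i)

  maxFiber : ℕ
  maxFiber = foldr _⊔_ 0 (map fiberSize (allFin m))

  Xeq : Pred (Fin n) _
  Xeq i = size i ≡ maxFiber

  Xeq? : Decidable Xeq
  Xeq? i = size i ≟ maxFiber

  Xneq : Pred (Fin n) _
  Xneq i = ¬ Xeq i

  Xneq? : Decidable Xneq
  Xneq? i = ¬? (Xeq? i)

  -- D = {i : S(α i) < S(i)}; since S = ln|·| is strictly increasing on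
  -- positive sizes, S(α i) < S(i) ⇔ |α i| < |i|
  D : Pred (Fin n) _
  D i = size (α i) < size i

  D? : Decidable D
  D? i = size (α i) <? size i

  I : Pred (Fin n) _
  I i = size (α i) > size i

  I? : Decidable I
  I? i = size i <? size (α i)

  D∩Xeq? : Decidable (D ∩ Xeq)
  D∩Xeq? i = D? i ×-dec Xeq? i

  I∩Xneq? : Decidable (I ∩ Xneq)
  I∩Xneq? i = I? i ×-dec Xneq? i

  EqDominant : ℚ → Set
  EqDominant ε₁ = (1ℚ - ε₁) * ℕ→ℚ n ≤ ℕ→ℚ (card Xeq?)

  EqDecreasing : ℚ → Set
  EqDecreasing ε₂ = (1ℚ - ε₂) * ℕ→ℚ (card Xneq?) ≤ ℕ→ℚ (card D∩Xeq?)

  L₁ : ℚ → Set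
  L₁ ε₁ = ℕ→ℚ (card D?) ≤ ε₁ * ℕ→ℚ n

  GAT : ℚ → Set
  GAT ε₂ = (1ℚ - ε₂) * ℕ→ℚ (card Xneq?) ≤ ℕ→ℚ (card I∩Xneq?)

  L₂ : ℚ → ℚ → Set
  L₂ ε₁ ε₂ = L₁ ε₁ × GAT ε₂

{-# OPTIONS --safe #-}
module Submission where

-- A step that lowers the entropy of a microstate cannot land in equilibrium, so α
-- maps D injectively into X^neq and |D| ≤ |X^neq| = |X| - |X^eq| ≤ ε₁|X|.
-- Since α is a bijection, X^eq and its preimage α⁻¹ X^eq have the same size, hence
-- exactly as many equilibrium points leave X^eq as non-equilibrium points enter it:
-- |X^eq ∖ α⁻¹ X^eq| = |α⁻¹ X^eq ∖ X^eq|. The first set contains D ∩ X^eq and the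
-- second is contained in I ∩ X^neq, which gives GAT(ε₂).

open import Defs
open import Data.Nat using (ℕ)
open import Data.Rational using (ℚ; _≤_; 0ℚ; 1ℚ)
open import Data.Product using (_×_)

open import Level using (0ℓ)
open import Data.Empty using (⊥-elim)
open import Data.Fin using (Fin)
open import Data.Integer as ℤ using (+_; +≤+)
import Data.Integer.Properties as ℤ
open import Data.List using (List; []; _∷_; length; filter; map; foldr)
open import Data.List.Membership.Propositional using (_∈_; _─_)
open import Data.List.Membership.Propositional.Properties using (∈-map⁺; ∈-map⁻; ∈-filter⁺; ∈-filter⁻; ∈-allFin)
open import Data.List.Properties using (length-removeAt′; length-map; filter-all; length-tabulate)
open import Data.List.Relation.Binary.Subset.Propositional renaming (_⊆_ to _⊆ˡ_)
open import Data.List.Relation.Unary.All as All using ()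
open import Data.List.Relation.Unary.AllPairs using (_∷_)
open import Data.List.Relation.Unary.Any using (here; there; index)
open import Data.List.Relation.Unary.Unique.Propositional using (Unique)
import Data.List.Relation.Unary.Unique.Propositional.Properties as Unique
open import Data.Nat as ℕ using (suc; z≤n; s≤s; _⊔_) renaming (_≤_ to _≤ₙ_; _<_ to _<ₙ_; _+_ to _+ₙ_)
import Data.Nat.Coprimality as Coprime
import Data.Nat.Properties as ℕ
open import Data.Product using (_,_; proj₂; swap)
open import Data.Rational using (mkℚ; _+_; _*_; _-_; *≤*; toℚᵘ)
import Data.Rational.Properties as ℚ
open import Data.Rational.Solver using (module +-*-Solver)
open import Data.Rational.Unnormalised using (*≡*) renaming (_≃_ to _≃ᵘ_; _+_ to _+ᵘ_)
import Data.Rational.Unnormalised.Properties as ℚᵘ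
open import Data.Unit using (tt)
open import Function.Base using (_∘_)
open import Function.Definitions using (Injective)
open import Relation.Binary.PropositionalEquality
open import Relation.Nullary using (yes; no)
open import Relation.Unary using (Pred; Decidable; _⊆_; ∁; _∩_)
open import Relation.Unary.Properties using (U?; ∁?; _∩?_)

private
  variable
    A : Set
    n k : ℕ
    P Q : Pred (Fin n) 0ℓ

∈-─⁺ : ∀ {x y : A} {ys} (y∈ys : y ∈ ys) → x ∈ ys → x ≢ y → x ∈ ys ─ y∈ys
∈-─⁺ (here refl)  (here refl) x≢y = ⊥-elim (x≢y refl)
∈-─⁺ (there _)    (here refl) _   = here refl
∈-─⁺ (here refl)  (there x∈ys) _  = x∈ys
∈-─⁺ (there y∈ys) (there x∈ys) x≢y = there (∈-─⁺ y∈ys x∈ys x≢y)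

unique-⊆⇒length≤ : {xs ys : List A} → Unique xs → xs ⊆ˡ ys → length xs ≤ₙ length ys
unique-⊆⇒length≤ {xs = []}     _            _     = z≤n
unique-⊆⇒length≤ {xs = x ∷ xs} {ys} (x∉xs ∷ xs!) xs⊆ys = begin
  suc (length xs)          ≤⟨ s≤s (unique-⊆⇒length≤ xs! xs⊆ys─x) ⟩
  suc (length (ys ─ x∈ys)) ≡⟨ length-removeAt′ ys (index x∈ys) ⟨
  length ys                ∎
  where
  open ℕ.≤-Reasoning
  x∈ys : x ∈ ys
  x∈ys = xs⊆ys (here refl)
  xs⊆ys─x : xs ⊆ˡ ys ─ x∈ys
  xs⊆ys─x z∈xs = ∈-─⁺ x∈ys (xs⊆ys (there z∈xs)) (λ z≡x → All.lookup x∉xs z∈xs (sym z≡x))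

card-≤-injective : {P : Pred (Fin n) 0ℓ} {Q : Pred (Fin k) 0ℓ} (P? : Decidable P) (Q? : Decidable Q)
  (g : Fin n → Fin k) → Injective _≡_ _≡_ g → (∀ {i} → P i → Q (g i)) → card P? ≤ₙ card Q?
card-≤-injective {n} P? Q? g g-inj P⇒Q∘g =
  subst (_≤ₙ card Q?) (length-map g (filter P? (allFin n)))
    (unique-⊆⇒length≤ (Unique.map⁺ g-inj (Unique.filter⁺ P? (Unique.allFin⁺ n))) image⊆Q)
  where
  image⊆Q : map g (filter P? (allFin n)) ⊆ˡ filter Q? (allFin _)
  image⊆Q x∈image with ∈-map⁻ g x∈image
  ... | i , i∈P , refl =
    ∈-filter⁺ Q? (∈-allFin (g i)) (P⇒Q∘g (proj₂ (∈-filter⁻ P? {xs = allFin n} i∈P)))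

card-mono : (P? : Decidable P) (Q? : Decidable Q) → P ⊆ Q → card P? ≤ₙ card Q?
card-mono P? Q? P⊆Q = card-≤-injective P? Q? (λ i → i) (λ i≡j → i≡j) P⊆Q

card-cong : (P? : Decidable P) (Q? : Decidable Q) → P ⊆ Q → Q ⊆ P → card P? ≡ card Q?
card-cong P? Q? P⊆Q Q⊆P = ℕ.≤-antisym (card-mono P? Q? P⊆Q) (card-mono Q? P? Q⊆P)

card-U : card (U? {A = Fin n}) ≡ n
card-U {n} = trans (cong length (filter-all U? (All.universal _ (allFin n)))) (length-tabulate (λ i → i))

card-∩-∁ : (P? : Decidable P) (Q? : Decidable Q) → card P? ≡ card (P? ∩? Q?) +ₙ card (P? ∩? ∁? Q?)
card-∩-∁ {n} P? Q? = go (allFin n)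
  where
  go : ∀ xs → length (filter P? xs) ≡ length (filter (P? ∩? Q?) xs) +ₙ length (filter (P? ∩? ∁? Q?) xs)
  go []       = refl
  go (x ∷ xs) with P? x | Q? x
  ... | yes _ | yes _ = cong suc (go xs)
  ... | yes _ | no  _ = trans (cong suc (go xs)) (sym (ℕ.+-suc _ _))
  ... | no  _ | yes _ = go xs
  ... | no  _ | no  _ = go xs

card+card-∁ : {P : Pred (Fin n) 0ℓ} (P? : Decidable P) → card P? +ₙ card (∁? P?) ≡ n
card+card-∁ {n} P? = begin
  card P? +ₙ card (∁? P?)                        ≡⟨ cong₂ _+ₙ_ (card-cong P? (U? ∩? P?) (tt ,_) proj₂)
                                                               (card-cong (∁? P?) (U? ∩? ∁? P?) (tt ,_) proj₂) ⟩
  card (U? ∩? P?) +ₙ card (U? ∩? ∁? P?)          ≡⟨ card-∩-∁ U? P? ⟨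
  card (U? {A = Fin n})                          ≡⟨ card-U ⟩
  n                                              ∎
  where open ≡-Reasoning

card-∘-injective : (P? : Decidable P) (α : Fin n → Fin n) → Injective _≡_ _≡_ α →
  card (P? ∘ α) ≡ card P?
card-∘-injective {n} P? α α-inj =
  ℕ.≤-antisym P∘α≤P (ℕ.+-cancelʳ-≤ (card (∁? P?)) _ _ P+∁P≤P∘α+∁P)
  where
  P∘α≤P : card (P? ∘ α) ≤ₙ card P?
  P∘α≤P = card-≤-injective (P? ∘ α) P? α α-inj (λ Pαi → Pαi)
  P+∁P≤P∘α+∁P : card P? +ₙ card (∁? P?) ≤ₙ card (P? ∘ α) +ₙ card (∁? P?)
  P+∁P≤P∘α+∁P = begin
    card P? +ₙ card (∁? P?)               ≡⟨ card+card-∁ P? ⟩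
    n                                     ≡⟨ card+card-∁ (P? ∘ α) ⟨
    card (P? ∘ α) +ₙ card (∁? (P? ∘ α))   ≤⟨ ℕ.+-monoʳ-≤ (card (P? ∘ α)) ∁P∘α≤∁P ⟩
    card (P? ∘ α) +ₙ card (∁? P?)         ∎
    where
    open ℕ.≤-Reasoning
    ∁P∘α≤∁P : card (∁? (P? ∘ α)) ≤ₙ card (∁? P?)
    ∁P∘α≤∁P = card-≤-injective (∁? (P? ∘ α)) (∁? P?) α α-inj (λ ¬Pαi → ¬Pαi)

card-∖-sym : (P? : Decidable P) (Q? : Decidable Q) →
  card P? ≡ card Q? → card (P? ∩? ∁? Q?) ≡ card (Q? ∩? ∁? P?)
card-∖-sym P? Q? |P|≡|Q| = ℕ.+-cancelˡ-≡ (card (P? ∩? Q?)) _ _ (begin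
  card (P? ∩? Q?) +ₙ card (P? ∩? ∁? Q?)   ≡⟨ card-∩-∁ P? Q? ⟨
  card P?                                 ≡⟨ |P|≡|Q| ⟩
  card Q?                                 ≡⟨ card-∩-∁ Q? P? ⟩
  card (Q? ∩? P?) +ₙ card (Q? ∩? ∁? P?)   ≡⟨ cong (_+ₙ card (Q? ∩? ∁? P?)) Q∩P≡P∩Q ⟩
  card (P? ∩? Q?) +ₙ card (Q? ∩? ∁? P?)   ∎)
  where
  open ≡-Reasoning
  Q∩P≡P∩Q : card (Q? ∩? P?) ≡ card (P? ∩? Q?)
  Q∩P≡P∩Q = card-cong (Q? ∩? P?) (P? ∩? Q?) swap swap

ℕ→ℚ≡mkℚ : ∀ k → ℕ→ℚ k ≡ mkℚ (+ k) 0 (Coprime.sym (Coprime.1-coprimeTo k))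
ℕ→ℚ≡mkℚ k = ℚ.normalize-coprime (Coprime.sym (Coprime.1-coprimeTo k))

ℕ→ℚ-mono-≤ : ∀ {x y} → x ≤ₙ y → ℕ→ℚ x ≤ ℕ→ℚ y
ℕ→ℚ-mono-≤ {x} {y} x≤y rewrite ℕ→ℚ≡mkℚ x | ℕ→ℚ≡mkℚ y =
  *≤* (ℤ.*-monoʳ-≤-nonNeg (+ 1) (+≤+ x≤y))

ℕ→ℚ-+ : ∀ x y → ℕ→ℚ (x +ₙ y) ≡ ℕ→ℚ x + ℕ→ℚ y
ℕ→ℚ-+ x y = ℚ.toℚᵘ-injective
  (ℚᵘ.≃-trans unnormalised (ℚᵘ.≃-sym (ℚ.toℚᵘ-homo-+ (ℕ→ℚ x) (ℕ→ℚ y))))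
  where
  unnormalised : toℚᵘ (ℕ→ℚ (x +ₙ y)) ≃ᵘ toℚᵘ (ℕ→ℚ x) +ᵘ toℚᵘ (ℕ→ℚ y)
  unnormalised rewrite ℕ→ℚ≡mkℚ x | ℕ→ℚ≡mkℚ y | ℕ→ℚ≡mkℚ (x +ₙ y) = *≡* (begin
    + (x +ₙ y) ℤ.* + 1                         ≡⟨ ℤ.*-identityʳ _ ⟩
    + (x +ₙ y)                                 ≡⟨ ℤ.pos-+ x y ⟩
    + x ℤ.+ + y                                ≡⟨ cong₂ ℤ._+_ (ℤ.*-identityʳ (+ x)) (ℤ.*-identityʳ (+ y)) ⟨
    + x ℤ.* + 1 ℤ.+ + y ℤ.* + 1                ≡⟨ ℤ.*-identityʳ _ ⟨
    (+ x ℤ.* + 1 ℤ.+ + y ℤ.* + 1) ℤ.* + 1      ∎)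
    where open ≡-Reasoning

p+q≤r⇒[1-ε]r≤q⇒p≤εr : ∀ {p q r ε : ℚ} → p + q ≤ r → (1ℚ - ε) * r ≤ q → p ≤ ε * r
p+q≤r⇒[1-ε]r≤q⇒p≤εr {p} {q} {r} {ε} p+q≤r [1-ε]r≤q = begin
  p                                ≡⟨ solve 3 (λ p ε r → p := (p :+ (con 1ℚ :- ε) :* r) :+ (ε :* r :- r)) refl p ε r ⟩
  (p + (1ℚ - ε) * r) + (ε * r - r) ≤⟨ ℚ.+-monoˡ-≤ (ε * r - r) (ℚ.+-monoʳ-≤ p [1-ε]r≤q) ⟩
  (p + q) + (ε * r - r)            ≤⟨ ℚ.+-monoˡ-≤ (ε * r - r) p+q≤r ⟩
  r + (ε * r - r)                  ≡⟨ solve 2 (λ ε r → r :+ (ε :* r :- r) := ε :* r) refl ε r ⟩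
  ε * r                            ∎
  where
  open ℚ.≤-Reasoning
  open +-*-Solver

∈⇒≤foldr-⊔ : ∀ {x xs} → x ∈ xs → x ≤ₙ foldr _⊔_ 0 xs
∈⇒≤foldr-⊔ {xs = y ∷ ys} (here refl)  = ℕ.m≤m⊔n y _
∈⇒≤foldr-⊔ {xs = y ∷ ys} (there x∈ys) = ℕ.m≤n⇒m≤o⊔n y (∈⇒≤foldr-⊔ x∈ys)

module _ {n m : ℕ} (sys : MMDS n m) where
  open MMDS sys

  size≤maxFiber : ∀ i → size sys i ≤ₙ maxFiber sys
  size≤maxFiber i = ∈⇒≤foldr-⊔ (∈-map⁺ (fiberSize sys) (∈-allFin (f i)))

  D⇒α∈Xneq : ∀ {i} → D sys i → Xneq sys (α i)
  D⇒α∈Xneq {i} αi<i αi∈Xeq = ℕ.<-irrefl αi∈Xeq (ℕ.<-≤-trans αi<i (size≤maxFiber i))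

  Xneq∩α∈Xeq⇒I : ∀ {i} → Xneq sys i → Xeq sys (α i) → I sys i
  Xneq∩α∈Xeq⇒I {i} i∉Xeq αi∈Xeq =
    subst (size sys i <ₙ_) (sym αi∈Xeq) (ℕ.≤∧≢⇒< (size≤maxFiber i) i∉Xeq)

  module _ (α-inj : Injective _≡_ _≡_ α) where

    card-D+card-Xeq≤n : card (D? sys) +ₙ card (Xeq? sys) ≤ₙ n
    card-D+card-Xeq≤n = begin
      card (D? sys) +ₙ card (Xeq? sys)    ≤⟨ ℕ.+-monoˡ-≤ _ D≤Xneq ⟩
      card (Xneq? sys) +ₙ card (Xeq? sys) ≡⟨ ℕ.+-comm (card (Xneq? sys)) _ ⟩
      card (Xeq? sys) +ₙ card (Xneq? sys) ≡⟨ card+card-∁ (Xeq? sys) ⟩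
      n                                   ∎
      where
      open ℕ.≤-Reasoning
      D≤Xneq : card (D? sys) ≤ₙ card (Xneq? sys)
      D≤Xneq = card-≤-injective (D? sys) (Xneq? sys) α α-inj D⇒α∈Xneq

    card-D∩Xeq≤card-I∩Xneq : card (D∩Xeq? sys) ≤ₙ card (I∩Xneq? sys)
    card-D∩Xeq≤card-I∩Xneq = begin
      card (D∩Xeq? sys)   ≤⟨ card-mono (D∩Xeq? sys) leaving (λ (i∈D , i∈Xeq) → i∈Xeq , D⇒α∈Xneq i∈D) ⟩
      card leaving        ≡⟨ card-∖-sym (Xeq? sys) Xeq?∘α (sym (card-∘-injective (Xeq? sys) α α-inj)) ⟩
      card entering       ≤⟨ card-mono entering (I∩Xneq? sys) entering⊆I∩Xneq ⟩
      card (I∩Xneq? sys)  ∎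
      where
      open ℕ.≤-Reasoning
      Xeq?∘α : Decidable (Xeq sys ∘ α)
      Xeq?∘α = Xeq? sys ∘ α
      leaving : Decidable (Xeq sys ∩ ∁ (Xeq sys ∘ α))
      leaving = Xeq? sys ∩? ∁? Xeq?∘α
      entering : Decidable ((Xeq sys ∘ α) ∩ ∁ (Xeq sys))
      entering = Xeq?∘α ∩? ∁? (Xeq? sys)
      entering⊆I∩Xneq : (Xeq sys ∘ α) ∩ ∁ (Xeq sys) ⊆ I sys ∩ Xneq sys
      entering⊆I∩Xneq (αi∈Xeq , i∉Xeq) = Xneq∩α∈Xeq⇒I i∉Xeq αi∈Xeq , i∉Xeq

    EqDominant⇒L₁ : ∀ ε → EqDominant sys ε → L₁ sys ε
    EqDominant⇒L₁ ε = p+q≤r⇒[1-ε]r≤q⇒p≤εr {ε = ε}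
      (subst (_≤ ℕ→ℚ n) (ℕ→ℚ-+ (card (D? sys)) (card (Xeq? sys)))
        (ℕ→ℚ-mono-≤ card-D+card-Xeq≤n))

    EqDecreasing⇒GAT : ∀ ε → EqDecreasing sys ε → GAT sys ε
    EqDecreasing⇒GAT ε [1-ε]Xneq≤D∩Xeq =
      ℚ.≤-trans [1-ε]Xneq≤D∩Xeq (ℕ→ℚ-mono-≤ card-D∩Xeq≤card-I∩Xneq)

mainTheorem4 : {n m : ℕ} (sys : MMDS n m) → Invertible sys →
    (ε₁ ε₂ : ℚ) → 0ℚ ≤ ε₁ → ε₁ ≤ 1ℚ → 0ℚ ≤ ε₂ → ε₂ ≤ 1ℚ →
    (EqDominant sys ε₁ → L₁ sys ε₁)
    × (EqDecreasing sys ε₂ → GAT sys ε₂)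
    × (EqDominant sys ε₁ → EqDecreasing sys ε₂ → L₂ sys ε₁ ε₂)
mainTheorem4 sys (α-inj , _) ε₁ ε₂ _ _ _ _ =
  L₁-holds , GAT-holds , λ eqDominant eqDecreasing → L₁-holds eqDominant , GAT-holds eqDecreasing
  where
  L₁-holds : EqDominant sys ε₁ → L₁ sys ε₁
  L₁-holds = EqDominant⇒L₁ sys α-inj ε₁
  GAT-holds : EqDecreasing sys ε₂ → GAT sys ε₂
  GAT-holds = EqDecreasing⇒GAT sys α-inj ε₂
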